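{- If $G$ is an outer-planar graph and $H$ is an Eulerian-minor* of $G$, then $H$ is outer-planar.
   Context: All graphs are finite; loops and multiple edges are allowed. A graph is outer-planar if it has a plane embedding with all vertices on the outer face boundary. A cycle may be a loop or a pair of parallel edges. A cycle $C$ of $G$ is non-separating if removing the vertices of $C$ from $G$ does not increase the number of connected components, and induced if no two nonadjacent vertices of $C$ are joined by an edge of $G$; a peripheral cycle is an induced non-separating cycle. Regard each edge as consisting of two half-edges. A demotion of a vertex $v$ chooses two half-edges $e_1,e_2$ incident to $v$, deletes them, and glues the two remaining half-edges into a new edge (e.g. $(G-\{v_1v,vv_2\})\cup\{v_1v_2\}$; if $e_1,e_2$ form a loop the demotion deletes the loop). The demotion is admissible if $e_1ve_2$ is part of a peripheral cycle of $G$. A cycle-deletion is $G\mapsto G-E(C)$ for a cycle $C$. Contracting a non-loop edge $xy$ means deleting it and identifying $x$ and $y$, keeping all other edges. $H$ is an Eulerian-minor* of $G$ if $H$ is obtained (up to isomorphism) from $G$ by a finite sequence of edge contractions, cycle-deletions, isolated vertex deletions and admissible demotions. -}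

module Defs where

open import Data.Nat as ℕ using (ℕ; zero; suc; _≤_)
open import Data.Nat.DivMod using (_%_; m%n<n)
open import Data.Fin as Fin using (Fin; zero; suc; toℕ; fromℕ<; punchIn; punchOut; _<_)
open import Data.Fin.Properties using (any?) renaming (_≟_ to _≟F_)
open import Data.List using (List; []; _∷_; length; lookup; map; _++_; [_])
open import Data.Bool using (Bool; true; false; if_then_else_; _∨_)
open import Data.Product using (Σ; ∃; ∃-syntax; _×_; _,_; proj₁; proj₂)
open import Data.Sum using (_⊎_)
open import Data.Unit using (⊤)
open import Function using (_∘_)
open import Function.Bundles using (_⤖_; Bijection)
open import Function.Definitions using (Injective)
open import Relation.Nullary using (¬_; does; yes; no)
open import Relation.Binary.PropositionalEquality using (_≡_; _≢_; refl; sym)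
open import Relation.Binary.Construct.Closure.ReflexiveTransitive using (Star)

-- Finite multigraphs (loops and parallel edges allowed).
-- Vertices are Fin n; edges are the positions of the list E; edge i has
-- two half-edges (i , false) and (i , true) whose endpoints are the first
-- and second component of lookup E i.

record Graph : Set where
  constructor mkG
  field
    n : ℕ
    E : List (Fin n × Fin n)

open Graph public

EdgeIx : Graph → Set
EdgeIx G = Fin (length (E G))

ends : (G : Graph) → EdgeIx G → Fin (n G) × Fin (n G)
ends G i = lookup (E G) i

Joins : ∀ {m} → Fin m × Fin m → Fin m → Fin m → Set
Joins (a , b) u w = (a ≡ u × b ≡ w) ⊎ (a ≡ w × b ≡ u)

deleteEdges : {A : Set} (es : List A) → (Fin (length es) → Bool) → List A
deleteEdges []       p = []
deleteEdges (e ∷ es) p =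
  if p zero then deleteEdges es (p ∘ suc) else e ∷ deleteEdges es (p ∘ suc)

-- Cycles: distinct vertices v_0..v_k and distinct edges e_0..e_k with e_i
-- joining v_i and v_{i+1 mod (k+1)}.  k = 0: a loop; k = 1: two parallel edges.

next : ∀ {k} → Fin (suc k) → Fin (suc k)
next {k} i = fromℕ< (m%n<n (suc (toℕ i)) (suc k))

record Cycle (G : Graph) : Set where
  field
    k      : ℕ
    vs     : Fin (suc k) → Fin (n G)
    es     : Fin (suc k) → EdgeIx G
    vs-inj : Injective _≡_ _≡_ vs
    es-inj : Injective _≡_ _≡_ es
    joins  : ∀ i → Joins (ends G (es i)) (vs i) (vs (next i))

open Cycle public

VIn : {G : Graph} → Cycle G → Fin (n G) → Set
VIn C v = ∃[ i ] vs C i ≡ v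

data Reach (G : Graph) (P : Fin (n G) → Set) : Fin (n G) → Fin (n G) → Set where
  here : ∀ {u} → P u → Reach G P u u
  step : ∀ {u w v} (e : EdgeIx G) → Joins (ends G e) u w → P u →
         Reach G P w v → Reach G P u v

NumComp : (G : Graph) (P : Fin (n G) → Set) → ℕ → Set
NumComp G P c =
  Σ (Σ (Fin (n G)) P → Fin c) λ f →
    (∀ y → ∃[ x ] f x ≡ y) ×
    (∀ u w → (f u ≡ f w → Reach G P (proj₁ u) (proj₁ w)) ×
             (Reach G P (proj₁ u) (proj₁ w) → f u ≡ f w))

NonSeparating : {G : Graph} → Cycle G → Set
NonSeparating {G} C = ∀ c c′ → NumComp G (λ _ → ⊤) c →
  NumComp G (λ v → ¬ VIn C v) c′ → c′ ≤ c

Induced : {G : Graph} → Cycle G → Set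
Induced {G} C = ∀ i j (e : EdgeIx G) → vs C i ≢ vs C j →
  Joins (ends G e) (vs C i) (vs C j) →
  ∃[ l ] Joins (ends G (es C l)) (vs C i) (vs C j)

Peripheral : {G : Graph} → Cycle G → Set
Peripheral C = Induced C × NonSeparating C

Through : {G : Graph} → Cycle G → Fin (n G) → EdgeIx G → EdgeIx G → Set
Through C v e₁ e₂ = ∃[ i ] (vs C (next i) ≡ v ×
  ((es C i ≡ e₁ × es C (next i) ≡ e₂) ⊎ (es C i ≡ e₂ × es C (next i) ≡ e₁)))

HalfEdge : Graph → Set
HalfEdge G = EdgeIx G × Bool

at : (G : Graph) → HalfEdge G → Fin (n G)
at G (e , false) = proj₁ (ends G e)
at G (e , true)  = proj₂ (ends G e)

other : (G : Graph) → HalfEdge G → Fin (n G)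
other G (e , false) = proj₂ (ends G e)
other G (e , true)  = proj₁ (ends G e)

-- delete the two half-edges and glue the two remaining half-edges into a
-- new edge; if both half-edges belong to the same edge (a loop), delete it
demote : (G : Graph) → HalfEdge G → HalfEdge G → Graph
demote G h₁ h₂ with does (proj₁ h₁ ≟F proj₁ h₂)
... | true  = mkG (n G) (deleteEdges (E G) (λ j → does (j ≟F proj₁ h₁)))
... | false = mkG (n G)
  (deleteEdges (E G) (λ j → does (j ≟F proj₁ h₁) ∨ does (j ≟F proj₁ h₂))
    ++ [ (other G h₁ , other G h₂) ])

-- identify y with x (x ≢ y) and renumber the vertices
merge : ∀ {k} (x y : Fin (suc k)) → x ≢ y → Fin (suc k) → Fin k
merge x y x≢y v with v ≟F y
... | yes _  = punchOut {i = y} {j = x} (λ eq → x≢y (sym eq))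
... | no v≢y = punchOut {i = y} {j = v} (λ eq → v≢y (sym eq))

data Step : Graph → Graph → Set where
  contract : ∀ k (Es : List (Fin (suc k) × Fin (suc k))) (i : Fin (length Es))
    (ne : proj₁ (lookup Es i) ≢ proj₂ (lookup Es i)) →
    Step (mkG (suc k) Es)
         (mkG k (map (λ p → merge (proj₁ (lookup Es i)) (proj₂ (lookup Es i)) ne (proj₁ p)
                          , merge (proj₁ (lookup Es i)) (proj₂ (lookup Es i)) ne (proj₂ p))
                     (deleteEdges Es (λ j → does (j ≟F i)))))
  cycleDelete : ∀ G (C : Cycle G) →
    Step G (mkG (n G) (deleteEdges (E G) (λ j → does (any? (λ l → es C l ≟F j)))))
  isolatedDelete : ∀ k (v : Fin (suc k)) (Es : List (Fin k × Fin k)) →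
    Step (mkG (suc k) (map (λ p → punchIn v (proj₁ p) , punchIn v (proj₂ p)) Es)) (mkG k Es)
  admissibleDemote : ∀ G (v : Fin (n G)) (h₁ h₂ : HalfEdge G) → h₁ ≢ h₂ →
    at G h₁ ≡ v → at G h₂ ≡ v →
    (C : Cycle G) → Peripheral C → Through C v (proj₁ h₁) (proj₁ h₂) →
    Step G (demote G h₁ h₂)

Iso : Graph → Graph → Set
Iso G H = Σ (Fin (n G) ⤖ Fin (n H)) λ φ → Σ (EdgeIx G ⤖ EdgeIx H) λ ψ →
  ∀ i → Joins (ends H (Bijection.to ψ i))
              (Bijection.to φ (proj₁ (ends G i))) (Bijection.to φ (proj₂ (ends G i)))

EulerianMinor* : Graph → Graph → Set
EulerianMinor* H G = Σ Graph λ H′ → Star Step G H′ × Iso H′ H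

-- Outer-planarity: vertices placed in distinct positions on a circle (an
-- injective position map into Fin n), edges drawn as chords, no two chords cross.

StrictBetween : ∀ {m} → Fin m → Fin m → Fin m → Set
StrictBetween a b c = (a < c × c < b) ⊎ (b < c × c < a)

StrictOutside : ∀ {m} → Fin m → Fin m → Fin m → Set
StrictOutside a b c = c ≢ a × c ≢ b × ¬ StrictBetween a b c

Cross : ∀ {m} → Fin m × Fin m → Fin m × Fin m → Set
Cross (a , b) (c , d) =
  (StrictBetween a b c × StrictOutside a b d) ⊎ (StrictBetween a b d × StrictOutside a b c)

OuterPlanar : Graph → Set
OuterPlanar G = Σ (Fin (n G) → Fin (n G)) λ pos → Injective _≡_ _≡_ pos ×
  (∀ i j → ¬ Cross (pos (proj₁ (ends G i)) , pos (proj₂ (ends G i)))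
                   (pos (proj₁ (ends G j)) , pos (proj₂ (ends G j))))

{-# OPTIONS --safe #-}
-- Put the vertices on a line in the order of an outer-planar embedding; edges are chords, and
-- two chords cross iff their ends interleave.  Reading "c lies between a and b" as the parity
-- (a < c) xor (b < c) makes crossing symmetric and additive along paths: a chord avoiding y
-- that crosses x z crosses x y or y z.  Every Eulerian-minor* step keeps such a drawing free
-- of crossings.  Deletions only remove chords (freed positions are compacted).  Contracting x y
-- moves every end at y to x, and a moved chord a x is the path a y x of two existing chords.
-- An admissible demotion at v replaces the path v₁ v v₂ of an induced cycle C by the chord
-- v₁ v₂: a chord away from v cannot cross it by additivity, and a chord v d crossing it would
-- separate v₁ from v₂, although the rest of C joins them and, C being induced, meets neither
-- v nor d.
module Submission where

open import Defs
open import Algebra.Bundles using (CommutativeRing)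
open import Data.Bool using (Bool; true; false; not; _xor_)
open import Data.Bool.Properties
  using (xor-assoc; xor-same; xor-annihilates-not; xor-∧-commutativeRing)
  renaming (_≟_ to _≟ᵇ_)
open import Algebra.Properties.CommutativeSemigroup
  (CommutativeRing.+-commutativeSemigroup xor-∧-commutativeRing) using (interchange)
open import Data.Fin using (Fin; toℕ; punchIn; punchOut; _<_)
open import Data.Fin.Permutation using (↔⇒≡)
open import Data.Fin.Properties
  using (_≟_; _<?_; <-cmp; <-asym; <-irrefl; <⇒≢; ≤∧≢⇒<; toℕ-injective; toℕ<n; toℕ-fromℕ<;
         punchIn-injective; punchIn-mono-≤; punchInᵢ≢i; punchOut-injective; punchIn-punchOut)
open import Data.List using (List; _∷_; []; map; _++_; [_])
open import Data.List.Membership.Propositional using (_∈_)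
open import Data.List.Membership.Propositional.Properties using (∈-lookup; ∈-map⁺; ∈-map⁻; ∈-++⁻)
open import Data.List.Relation.Binary.Subset.Propositional using (_⊆_)
open import Data.List.Relation.Binary.Subset.Propositional.Properties using (map⁺)
open import Data.List.Relation.Unary.Any using (here; there; index)
open import Data.List.Relation.Unary.Any.Properties using (lookup-index)
open import Data.Nat as ℕ using (ℕ; zero; suc; _+_; _*_; _%_; _/_; s≤s)
open import Data.Nat.DivMod using (m≡m%n+[m/n]*n; %-distribˡ-+; m%n%n≡m%n; [m+n]%n≡m%n; m<n⇒m%n≡m)
open import Data.Nat.Divisibility using (_∣_; divides; ∣⇒≤)
open import Data.Nat.GeneralisedArithmetic using (fold; fold-+)
import Data.Nat.Properties as ℕ
open import Data.Product as × using (Σ; _×_; _,_; proj₁; proj₂)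
open import Data.Sum as ⊎ using (_⊎_; inj₁; inj₂)
open import Function using (_∘_; id)
open import Function.Bundles using (module Inverse)
open import Function.Definitions using (Injective)
open import Function.Properties.Bijection using (⤖⇒↔)
open import Relation.Binary.Core using (_Preserves_⟶_)
open import Relation.Binary.Construct.Closure.ReflexiveTransitive using (Star; ε; _◅_)
open import Relation.Binary.Definitions using (tri<; tri≈; tri>)
open import Relation.Binary.PropositionalEquality
  using (_≡_; _≢_; refl; sym; trans; cong; cong₂; subst; subst₂; module ≡-Reasoning)
open import Relation.Nullary using (¬_; does; proof; yes; no; contradiction)
open import Relation.Nullary.Decidable using (dec-true; dec-false; decidable-stable)
open import Relation.Nullary.Reflects using (ofʸ; ofⁿ)

open ≡-Reasoning

xor≡false⇒≡ : ∀ {x y} → x xor y ≡ false → x ≡ y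
xor≡false⇒≡ {false}         eq = sym eq
xor≡false⇒≡ {true}  {true}  _  = refl
xor≡false⇒≡ {true}  {false} ()

xor-transpose : ∀ p q r s → p xor q ≡ r xor s → p xor r ≡ q xor s
xor-transpose p q r s eq = xor≡false⇒≡ (begin
  (p xor r) xor (q xor s)  ≡⟨ interchange p r q s ⟩
  (p xor q) xor (r xor s)  ≡⟨ cong (_xor (r xor s)) eq ⟩
  (r xor s) xor (r xor s)  ≡⟨ xor-same (r xor s) ⟩
  false                    ∎)

module _ {m : ℕ} where

  below : Fin m → Fin m → Bool
  below a c = does (a <? c)

  below-true : ∀ {a c} → a < c → below a c ≡ true
  below-true {a} {c} = dec-true (a <? c)

  below-false : ∀ {a c} → ¬ a < c → below a c ≡ false
  below-false {a} {c} = dec-false (a <? c)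

  -- Meaningful only for c ∉ {a , b}, where it decides StrictBetween a b c.
  between : Fin m → Fin m → Fin m → Bool
  between a b c = below a c xor below b c

  Avoids : Fin m × Fin m → Fin m → Set
  Avoids (a , b) c = c ≢ a × c ≢ b

  below-flip : ∀ {a c} → a ≢ c → below c a ≡ not (below a c)
  below-flip {a} {c} a≢c with <-cmp a c
  ... | tri< a<c _ c≮a rewrite below-true a<c | below-false c≮a = refl
  ... | tri≈ _ a≡c _   = contradiction a≡c a≢c
  ... | tri> a≮c _ c<a rewrite below-false a≮c | below-true c<a = refl

  between-split : ∀ x y z c → between x z c ≡ between x y c xor between y z c
  between-split x y z c = sym (begin
    (X xor Y) xor (Y xor Z)  ≡⟨ xor-assoc X Y (Y xor Z) ⟩
    X xor (Y xor (Y xor Z))  ≡⟨ cong (X xor_) (sym (xor-assoc Y Y Z)) ⟩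
    X xor ((Y xor Y) xor Z)  ≡⟨ cong (λ w → X xor (w xor Z)) (xor-same Y) ⟩
    X xor Z                  ∎)
    where X = below x c; Y = below y c; Z = below z c

  between-converse : ∀ {a c d} → Avoids (c , d) a → between c d a ≡ below a c xor below a d
  between-converse {a} {c} {d} (a≢c , a≢d) = begin
    below c a xor below d a              ≡⟨ cong₂ _xor_ (below-flip a≢c) (below-flip a≢d) ⟩
    not (below a c) xor not (below a d)  ≡⟨ xor-annihilates-not (below a c) (below a d) ⟩
    below a c xor below a d              ∎

  StrictBetween⇒Avoids : ∀ {a b c} → StrictBetween a b c → Avoids (a , b) c
  StrictBetween⇒Avoids (inj₁ (a<c , c<b)) = <⇒≢ a<c ∘ sym , <⇒≢ c<b
  StrictBetween⇒Avoids (inj₂ (b<c , c<a)) = <⇒≢ c<a , <⇒≢ b<c ∘ sym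

  StrictBetween⇒between : ∀ {a b c} → StrictBetween a b c → between a b c ≡ true
  StrictBetween⇒between (inj₁ (a<c , c<b))
    rewrite below-true a<c | below-false (<-asym c<b) = refl
  StrictBetween⇒between (inj₂ (b<c , c<a))
    rewrite below-false (<-asym c<a) | below-true b<c = refl

  between⇒StrictBetween : ∀ {a b c} → Avoids (a , b) c → between a b c ≡ true →
                          StrictBetween a b c
  between⇒StrictBetween {a} {b} {c} (c≢a , c≢b) eq
    with below a c | proof (a <? c) | below b c | proof (b <? c)
  ... | true  | ofʸ a<c | false | ofⁿ b≮c = inj₁ (a<c , ≤∧≢⇒< (ℕ.≮⇒≥ b≮c) c≢b)
  ... | false | ofⁿ a≮c | true  | ofʸ b<c = inj₂ (b<c , ≤∧≢⇒< (ℕ.≮⇒≥ a≮c) c≢a)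
  between⇒StrictBetween _ () | true  | _ | true  | _
  between⇒StrictBetween _ () | false | _ | false | _

  ¬StrictBetween : ∀ {a b c} → between a b c ≡ false → ¬ StrictBetween a b c
  ¬StrictBetween eq sb with () ← trans (sym eq) (StrictBetween⇒between sb)

  Cross⇒ : ∀ {a b c d} → Cross (a , b) (c , d) →
           Avoids (a , b) c × Avoids (a , b) d × between a b c ≢ between a b d
  Cross⇒ (inj₁ (c-in , d≢a , d≢b , d-out)) =
    StrictBetween⇒Avoids c-in , (d≢a , d≢b) ,
    λ eq → d-out (between⇒StrictBetween (d≢a , d≢b) (trans (sym eq) (StrictBetween⇒between c-in)))
  Cross⇒ (inj₂ (d-in , c≢a , c≢b , c-out)) =
    (c≢a , c≢b) , StrictBetween⇒Avoids d-in ,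
    λ eq → c-out (between⇒StrictBetween (c≢a , c≢b) (trans eq (StrictBetween⇒between d-in)))

  ⇒Cross : ∀ {a b c d} → Avoids (a , b) c → Avoids (a , b) d →
           between a b c ≢ between a b d → Cross (a , b) (c , d)
  ⇒Cross {a} {b} {c} {d} c-off@(c≢a , c≢b) d-off@(d≢a , d≢b) differ
    with between a b c in ec | between a b d in ed
  ... | true  | false = inj₁ (between⇒StrictBetween c-off ec , d≢a , d≢b , ¬StrictBetween ed)
  ... | false | true  = inj₂ (between⇒StrictBetween d-off ed , c≢a , c≢b , ¬StrictBetween ec)
  ... | true  | true  = contradiction refl differ
  ... | false | false = contradiction refl differ

  ¬Cross⇒same-side : ∀ {a b c d} → ¬ Cross (a , b) (c , d) →
                     Avoids (a , b) c → Avoids (a , b) d → between a b c ≡ between a b d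
  ¬Cross⇒same-side ¬cross c-off d-off =
    decidable-stable (_ ≟ᵇ _) (¬cross ∘ ⇒Cross c-off d-off)

  StrictOutside-swap : ∀ {a b c : Fin m} → StrictOutside a b c → StrictOutside b a c
  StrictOutside-swap (c≢a , c≢b , out) = c≢b , c≢a , out ∘ ⊎.swap

  Cross-swapˡ : ∀ {a b} {Q} → Cross (a , b) Q → Cross (b , a) Q
  Cross-swapˡ (inj₁ (c-in , d-out)) = inj₁ (⊎.swap c-in , StrictOutside-swap d-out)
  Cross-swapˡ (inj₂ (d-in , c-out)) = inj₂ (⊎.swap d-in , StrictOutside-swap c-out)

  Cross-swapʳ : ∀ {P : Fin m × Fin m} {c d} → Cross P (c , d) → Cross P (d , c)
  Cross-swapʳ = ⊎.swap

  Cross-sym : ∀ {a b c d} → Cross (a , b) (c , d) → Cross (c , d) (a , b)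
  Cross-sym {a} {b} {c} {d} cross with Cross⇒ cross
  ... | (c≢a , c≢b) , (d≢a , d≢b) , differ =
    ⇒Cross (c≢a ∘ sym , d≢a ∘ sym) (c≢b ∘ sym , d≢b ∘ sym) λ eq →
      differ (xor-transpose (below a c) (below a d) (below b c) (below b d) (begin
        below a c xor below a d  ≡⟨ sym (between-converse (c≢a ∘ sym , d≢a ∘ sym)) ⟩
        between c d a            ≡⟨ eq ⟩
        between c d b            ≡⟨ between-converse (c≢b ∘ sym , d≢b ∘ sym) ⟩
        below b c xor below b d  ∎))

  ¬Cross-loop : ∀ {a Q} → ¬ Cross (a , a) Q
  ¬Cross-loop {a} {c , d} cross with Cross⇒ cross
  ... | _ , _ , differ = differ (trans (xor-same (below a c)) (sym (xor-same (below a d))))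

  ¬Cross-shared : ∀ {a b c d z} → a ≡ z ⊎ b ≡ z → c ≡ z ⊎ d ≡ z → ¬ Cross (a , b) (c , d)
  ¬Cross-shared a∨b c∨d cross with Cross⇒ cross | a∨b | c∨d
  ... | (c≢a , _) , _ | inj₁ refl | inj₁ refl = c≢a refl
  ... | (_ , c≢b) , _ | inj₂ refl | inj₁ refl = c≢b refl
  ... | _ , (d≢a , _) , _ | inj₁ refl | inj₂ refl = d≢a refl
  ... | _ , (_ , d≢b) , _ | inj₂ refl | inj₂ refl = d≢b refl

  ¬Cross-join : ∀ {x y z c d} → c ≢ y → d ≢ y →
                ¬ Cross (x , y) (c , d) → ¬ Cross (y , z) (c , d) → ¬ Cross (x , z) (c , d)
  ¬Cross-join {x} {y} {z} {c} {d} c≢y d≢y ¬xy ¬yz xz with Cross⇒ xz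
  ... | (c≢x , c≢z) , (d≢x , d≢z) , differ = differ (begin
    between x z c                    ≡⟨ between-split x y z c ⟩
    between x y c xor between y z c  ≡⟨ cong₂ _xor_
                                          (¬Cross⇒same-side ¬xy (c≢x , c≢y) (d≢x , d≢y))
                                          (¬Cross⇒same-side ¬yz (c≢y , c≢z) (d≢y , d≢z)) ⟩
    between x y d xor between y z d  ≡⟨ sym (between-split x y z d) ⟩
    between x z d                    ∎)

module _ {m m′ : ℕ} {f : Fin m → Fin m′} (f-mono : f Preserves _<_ ⟶ _<_) where

  mono-reflects-< : ∀ {a b} → f a < f b → a < b
  mono-reflects-< {a} {b} fa<fb with <-cmp a b
  ... | tri< a<b _ _  = a<b
  ... | tri≈ _ refl _ = contradiction fa<fb (<-irrefl refl)
  ... | tri> _ _ b<a  = contradiction (f-mono b<a) (<-asym fa<fb)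

  mono-injective : Injective _≡_ _≡_ f
  mono-injective {a} {b} fa≡fb with <-cmp a b
  ... | tri< a<b _ _ = contradiction fa≡fb (<⇒≢ (f-mono a<b))
  ... | tri≈ _ a≡b _ = a≡b
  ... | tri> _ _ b<a = contradiction (sym fa≡fb) (<⇒≢ (f-mono b<a))

  StrictBetween-mono : ∀ {a b c} → StrictBetween a b c → StrictBetween (f a) (f b) (f c)
  StrictBetween-mono = ⊎.map (×.map f-mono f-mono) (×.map f-mono f-mono)

  StrictOutside-mono : ∀ {a b c} → StrictOutside a b c → StrictOutside (f a) (f b) (f c)
  StrictOutside-mono (c≢a , c≢b , out) =
    c≢a ∘ mono-injective , c≢b ∘ mono-injective ,
    out ∘ ⊎.map (×.map mono-reflects-< mono-reflects-<) (×.map mono-reflects-< mono-reflects-<)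

  Cross-mono : ∀ {a b c d} → Cross (a , b) (c , d) → Cross (f a , f b) (f c , f d)
  Cross-mono (inj₁ (c-in , d-out)) = inj₁ (StrictBetween-mono c-in , StrictOutside-mono d-out)
  Cross-mono (inj₂ (d-in , c-out)) = inj₂ (StrictBetween-mono d-in , StrictOutside-mono c-out)

punchIn-mono-< : ∀ {m} (p : Fin (suc m)) → punchIn p Preserves _<_ ⟶ _<_
punchIn-mono-< p {i} {j} i<j =
  ≤∧≢⇒< (punchIn-mono-≤ p i j (ℕ.<⇒≤ i<j)) (<⇒≢ i<j ∘ punchIn-injective p i j)

module _ {m : ℕ} where

  Joins-sym : ∀ {p : Fin m × Fin m} {a b} → Joins p a b → Joins p b a
  Joins-sym = ⊎.swap

  Joins-unique : ∀ {p : Fin m × Fin m} {a b c d} → Joins p a b → Joins p c d →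
                 (a ≡ c × b ≡ d) ⊎ (a ≡ d × b ≡ c)
  Joins-unique (inj₁ (refl , refl)) (inj₁ (refl , refl)) = inj₁ (refl , refl)
  Joins-unique (inj₁ (refl , refl)) (inj₂ (refl , refl)) = inj₂ (refl , refl)
  Joins-unique (inj₂ (refl , refl)) (inj₁ (refl , refl)) = inj₂ (refl , refl)
  Joins-unique (inj₂ (refl , refl)) (inj₂ (refl , refl)) = inj₁ (refl , refl)

  Cross-Joinsˡ : ∀ {m′} {f : Fin m → Fin m′} {p a b Q} → Joins p a b →
                 Cross (f a , f b) Q → Cross (×.map f f p) Q
  Cross-Joinsˡ (inj₁ (refl , refl)) = id
  Cross-Joinsˡ (inj₂ (refl , refl)) = Cross-swapˡ

  Cross-Joinsʳ : ∀ {m′} {f : Fin m → Fin m′} {p c d P} → Joins p c d →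
                 Cross P (f c , f d) → Cross P (×.map f f p)
  Cross-Joinsʳ (inj₁ (refl , refl)) = id
  Cross-Joinsʳ (inj₂ (refl , refl)) = Cross-swapʳ

[m+n]%d≡m⇒d∣n : ∀ m n d .{{_ : ℕ.NonZero d}} → (m + n) % d ≡ m → d ∣ n
[m+n]%d≡m⇒d∣n m n d eq = divides ((m + n) / d) (ℕ.+-cancelˡ-≡ m n ((m + n) / d * d) (begin
  m + n                          ≡⟨ m≡m%n+[m/n]*n (m + n) d ⟩
  (m + n) % d + (m + n) / d * d  ≡⟨ cong (_+ (m + n) / d * d) eq ⟩
  m + (m + n) / d * d            ∎))

[1+m%d]%d≡[1+m]%d : ∀ m d .{{_ : ℕ.NonZero d}} → suc (m % d) % d ≡ suc m % d
[1+m%d]%d≡[1+m]%d m d = begin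
  (1 + m % d) % d          ≡⟨ %-distribˡ-+ 1 (m % d) d ⟩
  (1 % d + m % d % d) % d  ≡⟨ cong (λ x → (1 % d + x) % d) (m%n%n≡m%n m d) ⟩
  (1 % d + m % d) % d      ≡⟨ %-distribˡ-+ 1 m d ⟨
  (1 + m) % d              ∎

module _ {k : ℕ} where

  toℕ-fold-next : ∀ (a : Fin (suc k)) t → toℕ (fold a next t) ≡ (toℕ a + t) % suc k
  toℕ-fold-next a zero =
    sym (trans (cong (_% suc k) (ℕ.+-identityʳ (toℕ a))) (m<n⇒m%n≡m (toℕ<n a)))
  toℕ-fold-next a (suc t) = begin
    toℕ (next (fold a next t))         ≡⟨ toℕ-fromℕ< _ ⟩
    suc (toℕ (fold a next t)) % suc k  ≡⟨ cong (λ x → suc x % suc k) (toℕ-fold-next a t) ⟩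
    suc ((toℕ a + t) % suc k) % suc k  ≡⟨ [1+m%d]%d≡[1+m]%d (toℕ a + t) (suc k) ⟩
    suc (toℕ a + t) % suc k            ≡⟨ cong (_% suc k) (ℕ.+-suc (toℕ a) t) ⟨
    (toℕ a + suc t) % suc k            ∎

  fold-next-period : ∀ a → fold a next (suc k) ≡ a
  fold-next-period a = toℕ-injective (begin
    toℕ (fold a next (suc k))  ≡⟨ toℕ-fold-next a (suc k) ⟩
    (toℕ a + suc k) % suc k    ≡⟨ [m+n]%n≡m%n (toℕ a) (suc k) ⟩
    toℕ a % suc k              ≡⟨ m<n⇒m%n≡m (toℕ<n a) ⟩
    toℕ a                      ∎)

  fold-next-≢ : ∀ a {t} → t ℕ.< k → fold a next (suc t) ≢ a
  fold-next-≢ a {t} t<k eq = ℕ.<⇒≱ (s≤s t<k) (∣⇒≤ k+1∣t+1)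
    where
      k+1∣t+1 : suc k ∣ suc t
      k+1∣t+1 = [m+n]%d≡m⇒d∣n (toℕ a) (suc t) (suc k)
                  (trans (sym (toℕ-fold-next a (suc t))) (cong toℕ eq))

  fold-after-next : ∀ a → fold (next a) next k ≡ a
  fold-after-next a = begin
    fold (next a) next k  ≡⟨ fold-+ a next k ⟨
    fold a next (k + 1)   ≡⟨ cong (fold a next) (ℕ.+-comm k 1) ⟩
    fold a next (suc k)   ≡⟨ fold-next-period a ⟩
    a                     ∎

  next-injective : Injective _≡_ _≡_ (next {k})
  next-injective {a} {b} eq = begin
    a                     ≡⟨ fold-after-next a ⟨
    fold (next a) next k  ≡⟨ cong (λ x → fold x next k) eq ⟩
    fold (next b) next k  ≡⟨ fold-after-next b ⟩
    b                     ∎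

-- The walk once around the cycle from next (next a) back to a takes only steps avoiding next a.
neighbours-agree : ∀ {k} {A : Set} (g : Fin (suc k) → A) (a : Fin (suc k)) →
                   (∀ j → j ≢ next a → next j ≢ next a → g (next j) ≡ g j) →
                   g (next (next a)) ≡ g a
neighbours-agree {zero} g a _ =
  cong g (trans (cong next (fold-next-period a)) (fold-next-period a))
neighbours-agree {suc k} g a agree = begin
  g (next (next a))               ≡⟨ walk k ℕ.≤-refl ⟨
  g (fold (next a) next (suc k))  ≡⟨ cong g (fold-after-next a) ⟩
  g a                             ∎
  where
    walk : ∀ t → t ℕ.≤ k → g (fold (next a) next (suc t)) ≡ g (next (next a))
    walk zero    _   = refl
    walk (suc t) t<k = trans (agree _ (fold-next-≢ (next a) (ℕ.m<n⇒m<1+n t<k))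
                                      (fold-next-≢ (next a) (s≤s t<k)))
                             (walk t (ℕ.<⇒≤ t<k))

NonCrossing : ∀ {n m} → (Fin n → Fin m) → List (Fin n × Fin n) → Set
NonCrossing pos Es = ∀ {p q} → p ∈ Es → q ∈ Es → ¬ Cross (×.map pos pos p) (×.map pos pos q)

-- OuterPlanar G is a Drawing (n G) G; other m leave room for the position of a deleted vertex.
record Drawing (m : ℕ) (G : Graph) : Set where
  constructor drawing
  field
    pos           : Fin (n G) → Fin m
    pos-injective : Injective _≡_ _≡_ pos
    noncrossing   : NonCrossing pos (E G)

  ¬Cross-edges : ∀ {e e′ a b c d} → Joins (ends G e) a b → Joins (ends G e′) c d →
                 ¬ Cross (pos a , pos b) (pos c , pos d)
  ¬Cross-edges ab cd =
    noncrossing (∈-lookup _) (∈-lookup _) ∘ Cross-Joinsʳ cd ∘ Cross-Joinsˡ ab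

OuterPlanar⇒Drawing : ∀ {G} → OuterPlanar G → Drawing (n G) G
OuterPlanar⇒Drawing (pos , pos-injective , noncrossing) = drawing pos pos-injective λ p∈ q∈ →
  subst₂ (λ p q → ¬ Cross (×.map pos pos p) (×.map pos pos q))
         (sym (lookup-index p∈)) (sym (lookup-index q∈)) (noncrossing (index p∈) (index q∈))

Drawing⇒OuterPlanar : ∀ {G} → Drawing (n G) G → OuterPlanar G
Drawing⇒OuterPlanar (drawing pos pos-injective noncrossing) =
  pos , pos-injective , λ i j → noncrossing (∈-lookup i) (∈-lookup j)

∈⇒Joins : ∀ {G p} → p ∈ E G → Σ (EdgeIx G) λ e → Joins (ends G e) (proj₁ p) (proj₂ p)
∈⇒Joins {p = p} p∈ =
  index p∈ , subst (λ q → Joins q (proj₁ p) (proj₂ p)) (lookup-index p∈) (inj₁ (refl , refl))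

deleteEdges-⊆ : ∀ {A : Set} (es : List A) p → deleteEdges es p ⊆ es
deleteEdges-⊆ []       p ()
deleteEdges-⊆ (e ∷ es) p x∈ with p Fin.zero
... | true = there (deleteEdges-⊆ es (p ∘ Fin.suc) x∈)
deleteEdges-⊆ (e ∷ es) p (here x≡e)  | false = here x≡e
deleteEdges-⊆ (e ∷ es) p (there x∈) | false = there (deleteEdges-⊆ es (p ∘ Fin.suc) x∈)

module _ {n m : ℕ} {pos : Fin n → Fin m} where

  NonCrossing-⊆ : ∀ {Es Es′} → Es′ ⊆ Es → NonCrossing pos Es → NonCrossing pos Es′
  NonCrossing-⊆ sub noncrossing p∈ q∈ = noncrossing (sub p∈) (sub q∈)

  NonCrossing-map⁺ : ∀ {n′} {f : Fin n′ → Fin n} {Es} →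
                     NonCrossing (pos ∘ f) Es → NonCrossing pos (map (×.map f f) Es)
  NonCrossing-map⁺ noncrossing p∈ q∈
    with ∈-map⁻ _ p∈ | ∈-map⁻ _ q∈
  ... | _ , p′∈ , refl | _ , q′∈ , refl = noncrossing p′∈ q′∈

  NonCrossing-map⁻ : ∀ {n′} {f : Fin n′ → Fin n} {Es} →
                     NonCrossing pos (map (×.map f f) Es) → NonCrossing (pos ∘ f) Es
  NonCrossing-map⁻ noncrossing p∈ q∈ = noncrossing (∈-map⁺ _ p∈) (∈-map⁺ _ q∈)

  NonCrossing-snoc : ∀ {Es p} → NonCrossing pos Es →
                     (∀ {q} → q ∈ Es → ¬ Cross (×.map pos pos p) (×.map pos pos q)) →
                     NonCrossing pos (Es ++ [ p ])
  NonCrossing-snoc {Es} noncrossing new q∈ r∈ with ∈-++⁻ Es q∈ | ∈-++⁻ Es r∈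
  ... | inj₁ q∈Es        | inj₁ r∈Es        = noncrossing q∈Es r∈Es
  ... | inj₁ q∈Es        | inj₂ (here refl) = new q∈Es ∘ Cross-sym
  ... | inj₂ (here refl) | inj₁ r∈Es        = new r∈Es
  ... | inj₂ (here refl) | inj₂ (here refl) = ¬Cross-shared (inj₁ refl) (inj₁ refl)

Drawing-⊆ : ∀ {m n Es Es′} → Es′ ⊆ Es → Drawing m (mkG n Es) → Drawing m (mkG n Es′)
Drawing-⊆ sub (drawing pos pos-injective noncrossing) =
  drawing pos pos-injective (NonCrossing-⊆ sub noncrossing)

Drawing-punchOut : ∀ {m G} (D : Drawing (suc m) G) (p : Fin (suc m)) →
                   (∀ u → Drawing.pos D u ≢ p) → Drawing m G
Drawing-punchOut {m} {G} (drawing pos pos-injective noncrossing) p avoids =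
  drawing pos′ pos′-injective noncrossing′
  where
    pos′ : Fin (n G) → Fin m
    pos′ u = punchOut (avoids u ∘ sym)
    pos′-injective : Injective _≡_ _≡_ pos′
    pos′-injective {u} {w} = pos-injective ∘ punchOut-injective (avoids u ∘ sym) (avoids w ∘ sym)
    punchIn-pos′ : ∀ u → punchIn p (pos′ u) ≡ pos u
    punchIn-pos′ u = punchIn-punchOut _
    noncrossing′ : NonCrossing pos′ _
    noncrossing′ {a , b} {c , d} p∈ q∈ =
      noncrossing p∈ q∈ ∘
      subst₂ Cross (cong₂ _,_ (punchIn-pos′ a) (punchIn-pos′ b))
                   (cong₂ _,_ (punchIn-pos′ c) (punchIn-pos′ d)) ∘
      Cross-mono (punchIn-mono-< p)

Drawing-without : ∀ {k m Es} (pos : Fin (suc k) → Fin (suc m)) → Injective _≡_ _≡_ pos →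
                  (v : Fin (suc k)) → NonCrossing (pos ∘ punchIn v) Es → Drawing m (mkG k Es)
Drawing-without pos pos-injective v noncrossing =
  Drawing-punchOut (drawing (pos ∘ punchIn v) (punchIn-injective v _ _ ∘ pos-injective) noncrossing)
                   (pos v) (λ u → punchInᵢ≢i v u ∘ pos-injective)

module _ {n m : ℕ} {pos : Fin n → Fin m} (pos-injective : Injective _≡_ _≡_ pos)
         {Es : List (Fin n × Fin n)} (noncrossing : NonCrossing pos Es)
         {x y : Fin n} (xy∈ : (x , y) ∈ Es)
         {r : Fin n → Fin n} (r-spec : ∀ a → (a ≡ y × r a ≡ x) ⊎ (a ≢ y × r a ≡ a)) where

  private
    -- A redirected edge a y ↦ a x is the path a – y – x, whose pieces are edges.
    redirected-¬Cross : ∀ {a b C D} → (a , b) ∈ Es → C ≢ pos y → D ≢ pos y →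
                        (∀ {e} → e ∈ Es → ¬ Cross (×.map pos pos e) (C , D)) →
                        ¬ Cross (pos (r a) , pos (r b)) (C , D)
    redirected-¬Cross {a} {b} ab∈ C≢y D≢y clear with r-spec a | r-spec b
    ... | inj₁ (refl , ra) | inj₁ (refl , rb) rewrite ra | rb = ¬Cross-loop
    ... | inj₁ (refl , ra) | inj₂ (_ , rb)    rewrite ra | rb =
      ¬Cross-join C≢y D≢y (clear xy∈) (clear ab∈)
    ... | inj₂ (_ , ra)    | inj₁ (refl , rb) rewrite ra | rb =
      ¬Cross-join C≢y D≢y (clear ab∈) (clear xy∈ ∘ Cross-swapˡ)
    ... | inj₂ (_ , ra)    | inj₂ (_ , rb)    rewrite ra | rb = clear ab∈

    redirect-view : ∀ a b → (a ≢ y × b ≢ y × r a ≡ a × r b ≡ b) ⊎ (r a ≡ x ⊎ r b ≡ x)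
    redirect-view a b with r-spec a | r-spec b
    ... | inj₁ (_ , ra)    | _                = inj₂ (inj₁ ra)
    ... | inj₂ _           | inj₁ (_ , rb)    = inj₂ (inj₂ rb)
    ... | inj₂ (a≢y , ra)  | inj₂ (b≢y , rb)  = inj₁ (a≢y , b≢y , ra , rb)

  NonCrossing-redirect : NonCrossing (pos ∘ r) Es
  NonCrossing-redirect {a , b} {c , d} ab∈ cd∈ with redirect-view c d | redirect-view a b
  ... | inj₁ (c≢y , d≢y , rc , rd) | _ rewrite rc | rd =
    redirected-¬Cross ab∈ (c≢y ∘ pos-injective) (d≢y ∘ pos-injective) (λ e∈ → noncrossing e∈ cd∈)
  ... | inj₂ _ | inj₁ (a≢y , b≢y , ra , rb) rewrite ra | rb =
    redirected-¬Cross cd∈ (a≢y ∘ pos-injective) (b≢y ∘ pos-injective) (λ e∈ → noncrossing e∈ ab∈)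
    ∘ Cross-sym
  ... | inj₂ x∈cd | inj₂ x∈ab =
    ¬Cross-shared (⊎.map (cong pos) (cong pos) x∈ab) (⊎.map (cong pos) (cong pos) x∈cd)

merge-spec : ∀ {k} (x y : Fin (suc k)) (x≢y : x ≢ y) a →
             (a ≡ y × punchIn y (merge x y x≢y a) ≡ x) ⊎ (a ≢ y × punchIn y (merge x y x≢y a) ≡ a)
merge-spec x y x≢y a with a ≟ y
... | yes a≡y = inj₁ (a≡y , punchIn-punchOut _)
... | no  a≢y = inj₂ (a≢y , punchIn-punchOut _)

contract-drawing : ∀ {k m Es} {x y : Fin (suc k)} (x≢y : x ≢ y) → (x , y) ∈ Es →
                   Drawing (suc m) (mkG (suc k) Es) →
                   Drawing m (mkG k (map (×.map (merge x y x≢y) (merge x y x≢y)) Es))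
contract-drawing {x = x} {y} x≢y xy∈ (drawing pos pos-injective noncrossing) =
  Drawing-without pos pos-injective y
    (NonCrossing-map⁺ (NonCrossing-redirect pos-injective noncrossing xy∈ (merge-spec x y x≢y)))

induced-neighbour : ∀ {G} {C : Cycle G} → Induced C → ∀ {e} i j →
                    vs C (next i) ≢ vs C j → Joins (ends G e) (vs C (next i)) (vs C j) →
                    j ≡ next (next i) ⊎ j ≡ i
induced-neighbour {C = C} induced i j v≢ joined with induced (next i) j _ v≢ joined
... | l , l-joins with Joins-unique l-joins (joins C l)
... | inj₁ (v≡l , j≡l+1)   = inj₁ (trans (vs-inj C j≡l+1) (cong next (vs-inj C (sym v≡l))))
... | inj₂ (v≡l+1 , j≡l)   = inj₂ (trans (vs-inj C j≡l) (next-injective (vs-inj C (sym v≡l+1))))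

module _ {m} {G : Graph} (D : Drawing m G) {C : Cycle G} (induced : Induced C)
         (i : Fin (suc (k C))) where

  open Drawing D

  private
    v = vs C (next i)
    v₁ = vs C i
    v₂ = vs C (next (next i))

    spoke-avoids : ∀ {e d} → Joins (ends G e) v d → pos v₁ ≢ pos d → pos v₂ ≢ pos d →
                   ∀ j → j ≢ next i → Avoids (pos v , pos d) (pos (vs C j))
    spoke-avoids {e} {d} vd v₁≢d v₂≢d j j≢i+1 = v-off , d-off
      where
        v-off : pos (vs C j) ≢ pos v
        v-off = j≢i+1 ∘ vs-inj C ∘ pos-injective
        d-off : pos (vs C j) ≢ pos d
        d-off eq with induced-neighbour {C = C} induced {e} i j (v-off ∘ cong pos ∘ sym)
                        (subst (Joins (ends G e) v) (sym (pos-injective eq)) vd)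
        ... | inj₁ refl = v₂≢d eq
        ... | inj₂ refl = v₁≢d eq

    -- The rest of C runs from v₂ to v₁ without meeting the spoke v d.
    spoke-same-side : ∀ {e d} → Joins (ends G e) v d → pos v₁ ≢ pos d → pos v₂ ≢ pos d →
                      between (pos v) (pos d) (pos v₂) ≡ between (pos v) (pos d) (pos v₁)
    spoke-same-side {e} {d} vd v₁≢d v₂≢d = neighbours-agree side i agree
      where
        side : Fin (suc (k C)) → Bool
        side j = between (pos v) (pos d) (pos (vs C j))
        agree : ∀ j → j ≢ next i → next j ≢ next i → side (next j) ≡ side j
        agree j j≢i+1 j+1≢i+1 = sym (¬Cross⇒same-side (¬Cross-edges vd (joins C j))
          (spoke-avoids vd v₁≢d v₂≢d j j≢i+1) (spoke-avoids vd v₁≢d v₂≢d (next j) j+1≢i+1))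

    spoke-¬Cross : ∀ {e d} → Joins (ends G e) v d → ¬ Cross (pos v₁ , pos v₂) (pos v , pos d)
    spoke-¬Cross vd cross =
      let (_ , v₁≢d) , (_ , v₂≢d) , sides-differ = Cross⇒ (Cross-sym cross)
      in  sides-differ (sym (spoke-same-side vd v₁≢d v₂≢d))

  shortcut-¬Cross : ∀ {e c d} → Joins (ends G e) c d → ¬ Cross (pos v₁ , pos v₂) (pos c , pos d)
  shortcut-¬Cross {c = c} {d} cd with c ≟ v | d ≟ v
  ... | yes refl | _        = spoke-¬Cross cd
  ... | no _     | yes refl = spoke-¬Cross (Joins-sym cd) ∘ Cross-swapʳ
  ... | no c≢v   | no d≢v   = ¬Cross-join (c≢v ∘ pos-injective) (d≢v ∘ pos-injective)
                                (¬Cross-edges (joins C i) cd) (¬Cross-edges (joins C (next i)) cd)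

other-Joins : ∀ G (h : HalfEdge G) {a w} → Joins (ends G (proj₁ h)) a w → at G h ≡ w →
              other G h ≡ a
other-Joins _ (e , false) (inj₁ (p , q)) at≡w = trans q (trans (sym at≡w) p)
other-Joins _ (e , false) (inj₂ (p , q)) at≡w = q
other-Joins _ (e , true)  (inj₁ (p , q)) at≡w = p
other-Joins _ (e , true)  (inj₂ (p , q)) at≡w = trans p (trans (sym at≡w) q)

Through-shortcut : ∀ {G v} {h₁ h₂ : HalfEdge G} (C : Cycle G) → at G h₁ ≡ v → at G h₂ ≡ v →
                   Through C v (proj₁ h₁) (proj₁ h₂) →
                   Σ (Fin (suc (k C))) λ i →
                     Joins (vs C i , vs C (next (next i))) (other G h₁) (other G h₂)
Through-shortcut {G} {h₁ = _ , s₁} {_ , s₂} C at₁ at₂ (i , v≡ , inj₁ (refl , refl)) =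
  i , inj₁ (sym (other-Joins G (es C i , s₁) (joins C i) (trans at₁ (sym v≡))) ,
            sym (other-Joins G (es C (next i) , s₂) (Joins-sym (joins C (next i)))
                             (trans at₂ (sym v≡))))
Through-shortcut {G} {h₁ = _ , s₁} {_ , s₂} C at₁ at₂ (i , v≡ , inj₂ (refl , refl)) =
  i , inj₂ (sym (other-Joins G (es C i , s₂) (joins C i) (trans at₂ (sym v≡))) ,
            sym (other-Joins G (es C (next i) , s₁) (Joins-sym (joins C (next i)))
                             (trans at₁ (sym v≡))))

demote-drawing : ∀ {G v} (h₁ h₂ : HalfEdge G) → at G h₁ ≡ v → at G h₂ ≡ v →
                 (C : Cycle G) → Induced C → Through C v (proj₁ h₁) (proj₁ h₂) →
                 Drawing (n G) G → Drawing (n (demote G h₁ h₂)) (demote G h₁ h₂)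
demote-drawing {G = G} h₁ h₂ at₁ at₂ C induced through D with does (proj₁ h₁ ≟ proj₁ h₂)
... | true  = Drawing-⊆ (deleteEdges-⊆ (E G) _) D
... | false = drawing pos pos-injective
                (NonCrossing-snoc (NonCrossing-⊆ (deleteEdges-⊆ (E G) _) noncrossing)
                                  (new-¬Cross ∘ deleteEdges-⊆ (E G) _))
  where
    open Drawing D
    new-¬Cross : ∀ {q} → q ∈ E G →
                 ¬ Cross (pos (other G h₁) , pos (other G h₂)) (×.map pos pos q)
    new-¬Cross q∈ with Through-shortcut {h₁ = h₁} {h₂} C at₁ at₂ through | ∈⇒Joins q∈
    ... | i , shortcut | _ , q-joins =
      shortcut-¬Cross D {C} induced i q-joins ∘ Cross-Joinsˡ {f = pos} shortcut

Iso-drawing : ∀ {G H} → Iso G H → Drawing (n G) G → Drawing (n H) H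
Iso-drawing {G} {H} (φ , ψ , φψ-joins) D =
  subst (λ m → Drawing m H) (↔⇒≡ (⤖⇒↔ φ))
    (drawing (pos ∘ from) (from-injective ∘ pos-injective) λ p∈ q∈ →
       ¬Cross-edges (proj₂ (source p∈)) (proj₂ (source q∈)))
  where
    open Drawing D
    open Inverse (⤖⇒↔ φ) using (to; from; strictlyInverseˡ; strictlyInverseʳ)
    module Ψ = Inverse (⤖⇒↔ ψ)

    from-injective : Injective _≡_ _≡_ from
    from-injective {u} {w} eq = begin
      u            ≡⟨ strictlyInverseˡ u ⟨
      to (from u)  ≡⟨ cong to eq ⟩
      to (from w)  ≡⟨ strictlyInverseˡ w ⟩
      w            ∎

    pullback : ∀ {p a b} → Joins p (to a) (to b) →
               Joins (a , b) (from (proj₁ p)) (from (proj₂ p))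
    pullback (inj₁ (refl , refl)) = inj₁ (sym (strictlyInverseʳ _) , sym (strictlyInverseʳ _))
    pullback (inj₂ (refl , refl)) = inj₂ (sym (strictlyInverseʳ _) , sym (strictlyInverseʳ _))

    source : ∀ {p} → p ∈ E H →
             Σ (EdgeIx G) λ e → Joins (ends G e) (from (proj₁ p)) (from (proj₂ p))
    source {p} p∈ = e , pullback (subst (λ q → Joins q (to a) (to b)) (sym p≡) (φψ-joins e))
      where
        e = Ψ.from (index p∈)
        a = proj₁ (ends G e)
        b = proj₂ (ends G e)
        p≡ : p ≡ ends H (Ψ.to e)
        p≡ = trans (lookup-index p∈) (cong (ends H) (sym (Ψ.strictlyInverseˡ (index p∈))))

Step-drawing : ∀ {G H} → Step G H → Drawing (n G) G → Drawing (n H) H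
Step-drawing (contract k Es i x≢y) =
  Drawing-⊆ (map⁺ _ (deleteEdges-⊆ Es _)) ∘ contract-drawing x≢y (∈-lookup i)
Step-drawing (cycleDelete G C) = Drawing-⊆ (deleteEdges-⊆ (E G) _)
Step-drawing (isolatedDelete k v Es) (drawing pos pos-injective noncrossing) =
  Drawing-without pos pos-injective v (NonCrossing-map⁻ noncrossing)
Step-drawing (admissibleDemote G v h₁ h₂ _ at₁ at₂ C (induced , _) through) =
  demote-drawing h₁ h₂ at₁ at₂ C induced through

Star-drawing : ∀ {G H} → Star Step G H → Drawing (n G) G → Drawing (n H) H
Star-drawing ε          = id
Star-drawing (s ◅ steps) = Star-drawing steps ∘ Step-drawing s

proposition5 : (G H : Graph) → OuterPlanar G → EulerianMinor* H G → OuterPlanar H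
proposition5 G H outer (H′ , steps , H′≅H) =
  Drawing⇒OuterPlanar (Iso-drawing {H′} {H} H′≅H (Star-drawing steps (OuterPlanar⇒Drawing outer)))
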